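{- Let $p>2$ be a prime and let $\mathbb{F}_p$ be the field with $p$ elements. Define the sequence $(x_1,\ldots,x_p)$ of elements of $\mathbb{F}_p$ by $x_1=0$, and $x_{2j}=j$, $x_{2j+1}=p-j$ for $1\le j\le (p-1)/2$ (so the sequence is $0,1,p-1,2,p-2,\ldots$). Then this sequence is a sequencing of the natural $2$-transitive action of the affine group $\mathrm{Aff}(\mathbb{F}_p)=\{x\mapsto ax+b: a\in\mathbb{F}_p^*, b\in\mathbb{F}_p\}$ on $\mathbb{F}_p$. In particular, a $(p,3)$-permutation design exists for every odd prime $p$.
   Context: The affine group acts sharply $2$-transitively on $\mathbb{F}_p$: for any two ordered pairs of distinct elements there is exactly one affine map sending the first to the second. For a set $X$, $X^{(3)}$ denotes ordered triples of distinct elements, with coordinatewise action. A sequencing of this action is an enumeration $(x_1,\ldots,x_p)$ of all elements of $\mathbb{F}_p$ such that the $p-2$ triples $(x_i,x_{i+1},x_{i+2})$, $1\le i\le p-2$, lie in pairwise distinct orbits of $\mathrm{Aff}(\mathbb{F}_p)$ on $X^{(3)}$. For $n\ge t\ge1$ let $n^{\underline{t}}=n(n-1)\cdots(n-t+1)$; an $(n,t)$-permutation design is a set of $n^{\underline{t-1}}$ permutations of an $n$-set such that every ordered $t$-tuple of distinct elements occurs exactly once as a contiguous subsequence of one of the permutations. -}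

module Defs where

open import Data.Nat using (ℕ; zero; suc; _+_; _*_; _∸_; NonZero)
open import Data.Nat.DivMod using (_mod_; _/_)
open import Data.Nat.Combinatorics using (_P_)
open import Data.Fin using (Fin; toℕ)
open import Data.List using (List; []; _∷_; _++_; map; concatMap; upTo; length; allFin)
open import Data.List.Relation.Unary.AllPairs using (AllPairs)
open import Data.List.Relation.Unary.Unique.Propositional using (Unique)
open import Data.List.Relation.Binary.Permutation.Propositional using (_↭_)
open import Data.Product using (Σ; ∃; _×_; _,_)
open import Relation.Binary.PropositionalEquality using (_≡_; _≢_)
open import Relation.Nullary using (¬_)
open import Function.Definitions using (Injective)

Triple : Set → Set
Triple A = A × A × A

aff : (p : ℕ) .{{_ : NonZero p}} → Fin p → Fin p → Fin p → Fin p
aff p a b x = ((toℕ a * toℕ x) + toℕ b) mod p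

SameOrbit : (p : ℕ) .{{_ : NonZero p}} → Triple (Fin p) → Triple (Fin p) → Set
SameOrbit p (u₁ , u₂ , u₃) (v₁ , v₂ , v₃) =
  ∃ λ (a : Fin p) → ∃ λ (b : Fin p) →
    (toℕ a ≢ 0) × (aff p a b u₁ ≡ v₁) × (aff p a b u₂ ≡ v₂) × (aff p a b u₃ ≡ v₃)

windows3 : {A : Set} → List A → List (Triple A)
windows3 (x ∷ y ∷ z ∷ rest) = (x , y , z) ∷ windows3 (y ∷ z ∷ rest)
windows3 _ = []

IsSequencing : (p : ℕ) .{{_ : NonZero p}} → List (Fin p) → Set
IsSequencing p xs =
  (xs ↭ allFin p) × AllPairs (λ u v → ¬ SameOrbit p u v) (windows3 xs)

zigzag : (p : ℕ) .{{_ : NonZero p}} → List (Fin p)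
zigzag p = (0 mod p) ∷ concatMap (λ j → (j mod p) ∷ ((p ∸ j) mod p) ∷ [])
                                  (map suc (upTo ((p ∸ 1) / 2)))

-- An (n,t)-permutation design: a set (injectively indexed family) of n^{(t-1)}
-- = n P (t-1) permutations of Fin n such that every ordered t-tuple of distinct
-- elements occurs exactly once as a contiguous subsequence of one of them.
-- An occurrence of u in permutation k is a split  P k ≡ pre ++ u ++ suf;
-- it is identified by (k, pre) (suf is then determined).
IsPermDesign : (n t : ℕ) → (Fin (n P (t ∸ 1)) → List (Fin n)) → Set
IsPermDesign n t Π =
  Injective _≡_ _≡_ Π ×
  (∀ k → Π k ↭ allFin n) ×
  (∀ (u : List (Fin n)) → length u ≡ t → Unique u →
     Σ (Fin (n P (t ∸ 1)) × List (Fin n) × List (Fin n)) λ { (k , pre , suf) →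
       (Π k ≡ pre ++ u ++ suf) ×
       (∀ k′ pre′ suf′ → Π k′ ≡ pre′ ++ u ++ suf′ → (k′ ≡ k) × (pre′ ≡ pre)) })

PermDesignExists : (n t : ℕ) → Set
PermDesignExists n t = ∃ λ Π → IsPermDesign n t Π

-- Model 𝔽ₚ by integers modulo p. For a triple (x, y, z) with x ≠ z the ratio c with
-- y - x = c (z - x) is invariant under x ↦ a x + b, and because Aff(𝔽ₚ) is sharply
-- 2-transitive it determines the orbit of the triple. The zigzag x₀, x₁, … = 0, 1, -1, 2, -2, …
-- has x_{i+1} - x_i = (-1)^i (i + 1) and x_{i+2} - x_i = -(-1)^i, so the window at x_i has
-- ratio -(i + 1); these p - 2 values are distinct, which gives the sequencing. They are also
-- exactly the ratios ≠ 0, 1 of triples of distinct points, so each such triple is the image of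
-- exactly one window under exactly one of the p (p - 1) affine maps: applying all affine maps to
-- the zigzag yields a (p, 3)-permutation design.

module Submission where

open import Data.Nat as ℕ using (ℕ; zero; suc; NonZero; z≤n; s≤s; _<_; _≤_)
import Data.Nat.Properties as ℕP
open import Data.Nat.DivMod using (_mod_; _/_; m≡m%n+[m/n]*n; m%n<n; m*n/n≡m)
open import Data.Nat.Primality using (Prime; prime⇒irreducible)
open import Data.Nat.Combinatorics using (_P_)
open import Data.Nat.Divisibility using (divides)
open import Data.Nat.Coprimality using (prime⇒coprime; coprime-Bézout)
open import Data.Nat.GCD using (module Bézout)
open import Data.Integer using (ℤ; +_; -[1+_]; +[1+_]; 0ℤ; 1ℤ; -1ℤ; _+_; _*_; -_; _-_)
import Data.Integer.Properties as ℤP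
open import Data.Integer.DivMod using (_/ℕ_; a≡a%ℕn+[a/ℕn]*n; n%ℕd<d)
open import Data.Integer.Tactic.RingSolver using (solve; solve-∀)
open import Data.Fin as F using (Fin; toℕ; fromℕ<)
import Data.Fin.Properties as FP
open import Data.Product using (Σ; ∃; ∃₂; _×_; _,_; proj₁; proj₂; uncurry)
open import Data.Sum using (inj₁; inj₂)
open import Data.Empty using (⊥-elim)
open import Data.List using (List; []; _∷_; _++_; map; concatMap; applyUpTo; upTo; allFin; length)
open import Data.List.Properties using (∷-injective; map-upTo)
open import Data.List.Relation.Unary.All as All using (All)
open import Data.List.Relation.Unary.AllPairs using (_∷_)
import Data.List.Relation.Unary.AllPairs.Properties as AllPairs
open import Data.List.Relation.Unary.Unique.Propositional using (Unique)
import Data.List.Relation.Unary.Unique.Propositional.Properties as Unique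
open import Data.List.Relation.Unary.Any using (here; there)
open import Data.List.Membership.Propositional using (_∈_)
open import Data.List.Membership.Propositional.Properties
  using (∈-++⁺ʳ; ∈-applyUpTo⁺; ∈-applyUpTo⁻; ∈-allFin; ∈-map⁺; ∈-map⁻)
open import Data.List.Membership.Propositional.Properties.WithK using (unique∧set⇒bag)
open import Data.List.Relation.Binary.Permutation.Propositional using (_↭_)
open import Data.List.Relation.Binary.BagAndSetEquality using (∼bag⇒↭)
open import Function using (_∘_)
open import Function.Bundles using (mk⇔)
open import Function.Definitions using (Injective; StrictlySurjective)
open import Level using (0ℓ)
open import Relation.Binary.Bundles using (Setoid)
import Relation.Binary.Reasoning.Setoid as SetoidReasoning
open import Relation.Binary.PropositionalEquality
open import Relation.Nullary using (¬_; yes; no)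

open import Defs

module _ {A : Set} where

  Unique-prefix : ∀ (pre pre′ : List A) {x suf suf′} → Unique (pre ++ x ∷ suf) →
                  pre ++ x ∷ suf ≡ pre′ ++ x ∷ suf′ → pre ≡ pre′
  Unique-prefix []        []          _           _  = refl
  Unique-prefix []        (y ∷ pre′)  (x∉suf ∷ _) eq with ∷-injective eq
  ... | refl , suf≡ = ⊥-elim (All.lookup x∉suf (subst (_ ∈_) (sym suf≡) (∈-++⁺ʳ pre′ (here refl))) refl)
  Unique-prefix (y ∷ pre) []          (y∉ ∷ _)    eq with ∷-injective eq
  ... | refl , _    = ⊥-elim (All.lookup y∉ (∈-++⁺ʳ pre (here refl)) refl)
  Unique-prefix (y ∷ pre) (y′ ∷ pre′) (_ ∷ u)     eq with ∷-injective eq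
  ... | refl , eq′  = cong (y ∷_) (Unique-prefix pre pre′ u eq′)

  Unique-triple⇒distinct : ∀ {x y z : A} → Unique (x ∷ y ∷ z ∷ []) → x ≢ y × x ≢ z × y ≢ z
  Unique-triple⇒distinct ((x≢y All.∷ x≢z All.∷ All.[]) ∷ (y≢z All.∷ All.[]) ∷ _) = x≢y , x≢z , y≢z

  ∈-windows3⁻ : ∀ (xs : List A) {x y z} → (x , y , z) ∈ windows3 xs →
                ∃₂ λ pre suf → xs ≡ pre ++ x ∷ y ∷ z ∷ suf
  ∈-windows3⁻ (x ∷ y ∷ z ∷ rest) (here refl) = [] , rest , refl
  ∈-windows3⁻ (x ∷ y ∷ z ∷ rest) (there w) with ∈-windows3⁻ (y ∷ z ∷ rest) w
  ... | pre , suf , eq = x ∷ pre , suf , cong (x ∷_) eq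

  ∈-windows3⁺ : ∀ pre suf {x y z : A} → (x , y , z) ∈ windows3 (pre ++ x ∷ y ∷ z ∷ suf)
  ∈-windows3⁺ []                suf = here refl
  ∈-windows3⁺ (_ ∷ [])          suf = there (here refl)
  ∈-windows3⁺ (_ ∷ y ∷ [])      suf = there (∈-windows3⁺ (y ∷ []) suf)
  ∈-windows3⁺ (_ ∷ y ∷ z ∷ pre) suf = there (∈-windows3⁺ (y ∷ z ∷ pre) suf)

  windows3-applyUpTo : ∀ (f : ℕ → A) m →
    windows3 (applyUpTo f (suc (suc m))) ≡ applyUpTo (λ i → f i , f (suc i) , f (suc (suc i))) m
  windows3-applyUpTo f zero    = refl
  windows3-applyUpTo f (suc m) = cong (_ ∷_) (windows3-applyUpTo (f ∘ suc) m)

map₃ : {A B : Set} → (A → B) → Triple A → Triple B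
map₃ f (x , y , z) = f x , f y , f z

windows3-map : {A B : Set} (f : A → B) (xs : List A) → windows3 (map f xs) ≡ map (map₃ f) (windows3 xs)
windows3-map f []               = refl
windows3-map f (_ ∷ [])         = refl
windows3-map f (_ ∷ _ ∷ [])     = refl
windows3-map f (_ ∷ y ∷ z ∷ xs) = cong (_ ∷_) (windows3-map f (y ∷ z ∷ xs))

double : ℕ → ℕ
double zero    = zero
double (suc n) = suc (suc (double n))

data Parity : ℕ → Set where
  even : ∀ j → Parity (double j)
  odd  : ∀ j → Parity (suc (double j))

parity : ∀ n → Parity n
parity zero = even zero
parity (suc n) with parity n
... | even j = odd j
... | odd j  = even (suc j)

interleave : {A : Set} → (ℕ → A) → (ℕ → A) → ℕ → A
interleave f g zero          = f zero
interleave f g (suc zero)    = g zero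
interleave f g (suc (suc n)) = interleave (f ∘ suc) (g ∘ suc) n

module _ {A : Set} where

  interleave-even : ∀ (f g : ℕ → A) j → interleave f g (double j) ≡ f j
  interleave-even f g zero    = refl
  interleave-even f g (suc j) = interleave-even (f ∘ suc) (g ∘ suc) j

  interleave-odd : ∀ (f g : ℕ → A) j → interleave f g (suc (double j)) ≡ g j
  interleave-odd f g zero    = refl
  interleave-odd f g (suc j) = interleave-odd (f ∘ suc) (g ∘ suc) j

  concatMap-pairs : ∀ (f g : ℕ → A) (k : ℕ → ℕ) n →
    concatMap (λ j → f j ∷ g j ∷ []) (applyUpTo k n) ≡ applyUpTo (interleave (f ∘ k) (g ∘ k)) (double n)
  concatMap-pairs f g k zero    = refl
  concatMap-pairs f g k (suc n) = cong (λ xs → f (k 0) ∷ g (k 0) ∷ xs) (concatMap-pairs f g (k ∘ suc) n)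

double≡+ : ∀ n → double n ≡ n ℕ.+ n
double≡+ zero    = refl
double≡+ (suc n) = cong suc (trans (cong suc (double≡+ n)) (sym (ℕP.+-suc n n)))

double≡*2 : ∀ n → double n ≡ n ℕ.* 2
double≡*2 zero    = refl
double≡*2 (suc n) = cong (suc ∘ suc) (double≡*2 n)

n≤double : ∀ n → n ≤ double n
n≤double zero    = z≤n
n≤double (suc n) = s≤s (ℕP.≤-trans (n≤double n) (ℕP.n≤1+n _))

double-≤-reflect : ∀ {a b} → double a ≤ suc (double b) → a ≤ b
double-≤-reflect {zero}          _                = z≤n
double-≤-reflect {suc a} {suc b} (s≤s (s≤s le)) = s≤s (double-≤-reflect le)

Fin-injective⇒surjective : ∀ {n} (f : Fin n → Fin n) → Injective _≡_ _≡_ f → StrictlySurjective _≡_ f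
Fin-injective⇒surjective {suc n} f inj y with FP.any? (λ x → f x F.≟ y)
... | yes found  = found
... | no missing =
  let i , j , i<j , punchOutᵢ≡punchOutⱼ = FP.pigeonhole (ℕP.n<1+n n) (λ x → F.punchOut (avoids x))
  in ⊥-elim (FP.<⇒≢ i<j (inj (FP.punchOut-injective (avoids i) (avoids j) punchOutᵢ≡punchOutⱼ)))
  where
  avoids : ∀ x → y ≢ f x
  avoids x y≡fx = missing (x , sym y≡fx)

unique∧complete⇒↭allFin : ∀ {n} {xs : List (Fin n)} → Unique xs → (∀ y → y ∈ xs) → xs ↭ allFin n
unique∧complete⇒↭allFin {n} u complete =
  ∼bag⇒↭ (unique∧set⇒bag u (Unique.allFin⁺ n) (λ {y} → mk⇔ (λ _ → ∈-allFin y) (λ _ → complete y)))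

module Congruence (N : ℤ) where

  infix 4 _≈_ _≉_

  record _≈_ (x y : ℤ) : Set where
    constructor differBy
    field
      quotient   : ℤ
      difference : x ≡ y + quotient * N

  _≉_ : ℤ → ℤ → Set
  x ≉ y = ¬ x ≈ y

  ≈-reflexive : ∀ {x y} → x ≡ y → x ≈ y
  ≈-reflexive {x} refl = differBy 0ℤ (solve (x ∷ N ∷ []))

  ≈-refl : ∀ {x} → x ≈ x
  ≈-refl = ≈-reflexive refl

  ≈-sym : ∀ {x y} → x ≈ y → y ≈ x
  ≈-sym {x} {y} (differBy q eq) = differBy (- q) (begin
    y                  ≡⟨ solve (y ∷ q ∷ N ∷ []) ⟩
    y + q * N + - q * N ≡⟨ cong (λ t → t + - q * N) (sym eq) ⟩
    x + - q * N        ∎)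
    where open ≡-Reasoning

  ≈-trans : ∀ {x y z} → x ≈ y → y ≈ z → x ≈ z
  ≈-trans {z = z} (differBy q refl) (differBy r refl) = differBy (r + q) (solve (z ∷ q ∷ r ∷ N ∷ []))

  ≈-setoid : Setoid 0ℓ 0ℓ
  ≈-setoid = record
    { _≈_ = _≈_
    ; isEquivalence = record { refl = ≈-refl ; sym = ≈-sym ; trans = ≈-trans }
    }

  module ≈-Reasoning = SetoidReasoning ≈-setoid

  +-cong : ∀ {x x′ y y′} → x ≈ x′ → y ≈ y′ → x + y ≈ x′ + y′
  +-cong {x′ = x} {y′ = y} (differBy q refl) (differBy r refl) = differBy (q + r) (solve (x ∷ y ∷ q ∷ r ∷ N ∷ []))

  *-cong : ∀ {x x′ y y′} → x ≈ x′ → y ≈ y′ → x * y ≈ x′ * y′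
  *-cong {x′ = x} {y′ = y} (differBy q refl) (differBy r refl) =
    differBy (q * y + x * r + q * r * N) (solve (x ∷ y ∷ q ∷ r ∷ N ∷ []))

  -‿cong : ∀ {x y} → x ≈ y → - x ≈ - y
  -‿cong {y = y} (differBy q refl) = differBy (- q) (solve (y ∷ q ∷ N ∷ []))

  *-congˡ : ∀ x {y y′} → y ≈ y′ → x * y ≈ x * y′
  *-congˡ x = *-cong (≈-refl {x})

  -‿cancel : ∀ {x y} → - x ≈ - y → x ≈ y
  -‿cancel {x} {y} eq = ≈-trans (≈-reflexive (sym (ℤP.neg-involutive x)))
                          (≈-trans (-‿cong eq) (≈-reflexive (ℤP.neg-involutive y)))

  +-cancelʳ : ∀ {x y z} → x + z ≈ y + z → x ≈ y
  +-cancelʳ {x} {y} {z} eq = begin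
    x             ≡⟨ solve (x ∷ z ∷ []) ⟩
    (x + z) - z   ≈⟨ +-cong eq ≈-refl ⟩
    (y + z) - z   ≡⟨ solve (y ∷ z ∷ []) ⟩
    y             ∎
    where open ≈-Reasoning

  -≈0⇒≈ : ∀ {x y} → x - y ≈ 0ℤ → x ≈ y
  -≈0⇒≈ {x} {y} eq = +-cancelʳ (≈-trans eq (≈-reflexive (solve (y ∷ []))))

  +≡⇒≈- : ∀ {x y} → x + y ≡ N → x ≈ - y
  +≡⇒≈- {x} {y} eq = differBy 1ℤ (begin
    x           ≡⟨ solve (x ∷ y ∷ []) ⟩
    (x + y) - y ≡⟨ cong (_- y) eq ⟩
    N - y       ≡⟨ solve (y ∷ N ∷ []) ⟩
    - y + 1ℤ * N ∎)
    where open ≡-Reasoning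

  -- c stands for (Y - X) / (Z - X), the invariant of the triple (X, Y, Z) under Aff.
  record Ratio (c X Y Z : ℤ) : Set where
    constructor ratio
    field
      differences : Y - X ≈ c * (Z - X)

  Ratio-resp : ∀ {c X Y Z X′ Y′ Z′} → X ≈ X′ → Y ≈ Y′ → Z ≈ Z′ → Ratio c X Y Z → Ratio c X′ Y′ Z′
  Ratio-resp {c} {X} {Y} {Z} {X′} {Y′} {Z′} X≈ Y≈ Z≈ (ratio r) = ratio (begin
    Y′ - X′       ≈⟨ +-cong (≈-sym Y≈) (-‿cong (≈-sym X≈)) ⟩
    Y - X         ≈⟨ r ⟩
    c * (Z - X)   ≈⟨ *-congˡ c (+-cong Z≈ (-‿cong X≈)) ⟩
    c * (Z′ - X′) ∎)
    where open ≈-Reasoning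

  Ratio-cong : ∀ {c c′ X Y Z} → c ≈ c′ → Ratio c X Y Z → Ratio c′ X Y Z
  Ratio-cong c≈c′ (ratio r) = ratio (≈-trans r (*-cong c≈c′ ≈-refl))

  Ratio-affine : ∀ {c X Y Z} A B → Ratio c X Y Z → Ratio c (A * X + B) (A * Y + B) (A * Z + B)
  Ratio-affine {c} {X} {Y} {Z} A B (ratio r) = ratio (begin
    (A * Y + B) - (A * X + B)        ≡⟨ solve (A ∷ B ∷ X ∷ Y ∷ []) ⟩
    A * (Y - X)                      ≈⟨ *-congˡ A r ⟩
    A * (c * (Z - X))                ≡⟨ solve (A ∷ B ∷ c ∷ X ∷ Z ∷ []) ⟩
    c * ((A * Z + B) - (A * X + B))  ∎)
    where open ≈-Reasoning

  Ratio-middle : ∀ {c X Y Y′ Z} → Ratio c X Y Z → Ratio c X Y′ Z → Y ≈ Y′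
  Ratio-middle {c} {X} {Y} {Y′} {Z} (ratio r) (ratio r′) = begin
    Y              ≡⟨ solve (X ∷ Y ∷ []) ⟩
    (Y - X) + X    ≈⟨ +-cong (≈-trans r (≈-sym r′)) ≈-refl ⟩
    (Y′ - X) + X   ≡⟨ solve (X ∷ Y′ ∷ []) ⟩
    Y′             ∎
    where open ≈-Reasoning

  Ratio-zero : ∀ X Z → Ratio 0ℤ X X Z
  Ratio-zero X Z = ratio (≈-reflexive (solve (X ∷ Z ∷ [])))

  Ratio-one : ∀ X Z → Ratio 1ℤ X Z Z
  Ratio-one X Z = ratio (≈-reflexive (solve (X ∷ Z ∷ [])))

module Modulo (n : ℕ) .{{_ : NonZero n}} where

  open Congruence (+ n) public

  toℤ : Fin n → ℤ
  toℤ x = + toℕ x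

  pos-≈ : ∀ {a b} q → a ≡ b ℕ.+ q ℕ.* n → + a ≈ + b
  pos-≈ {a} {b} q eq = differBy (+ q) (begin
    + a                    ≡⟨ cong +_ eq ⟩
    + (b ℕ.+ q ℕ.* n)      ≡⟨ ℤP.pos-+ b (q ℕ.* n) ⟩
    + b + + (q ℕ.* n)      ≡⟨ cong (λ t → + b + t) (ℤP.pos-* q n) ⟩
    + b + + q * + n        ∎)
    where open ≡-Reasoning

  toℤ-mod : ∀ m → toℤ (m mod n) ≈ + m
  toℤ-mod m = ≈-sym (pos-≈ (m / n) (trans (m≡m%n+[m/n]*n m n)
                                      (cong (ℕ._+ m / n ℕ.* n) (sym (FP.toℕ-fromℕ< (m%n<n m n))))))

  reduce : ℤ → Fin n
  reduce z = fromℕ< (n%ℕd<d z n)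

  toℤ-reduce : ∀ z → toℤ (reduce z) ≈ z
  toℤ-reduce z = ≈-sym (differBy (z /ℕ n) (trans (a≡a%ℕn+[a/ℕn]*n z n)
                                   (cong (λ r → + r + (z /ℕ n) * + n) (sym (FP.toℕ-fromℕ< (n%ℕd<d z n))))))

  private
    no-wraparound : ∀ {a b k} → a < n → + a ≢ + b + +[1+ k ] * + n
    no-wraparound {a} {b} {k} a<n eq = ℕP.<⇒≱ a<n (begin
      n                  ≤⟨ ℕP.m≤n*m n (suc k) ⟩
      suc k ℕ.* n        ≤⟨ ℕP.m≤n+m _ b ⟩
      b ℕ.+ suc k ℕ.* n  ≡⟨ sym (ℤP.+-injective (trans eq (cong (λ t → + b + t) (sym (ℤP.pos-* (suc k) n))))) ⟩
      a                  ∎)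
      where open ℕP.≤-Reasoning

  ≈⇒≡ : ∀ {a b} → a < n → b < n → + a ≈ + b → a ≡ b
  ≈⇒≡ {a} {b} _   _   (differBy (+ zero) eq)   = ℤP.+-injective (trans eq (ℤP.+-identityʳ (+ b)))
  ≈⇒≡         a<n _   (differBy +[1+ k ] eq) = ⊥-elim (no-wraparound {k = k} a<n eq)
  ≈⇒≡         _   b<n (differBy -[1+ k ] eq) = ⊥-elim (no-wraparound {k = k} b<n (_≈_.difference (≈-sym (differBy -[1+ k ] eq))))

  toℤ-injective : ∀ {x y} → toℤ x ≈ toℤ y → x ≡ y
  toℤ-injective {x} {y} eq = FP.toℕ-injective (≈⇒≡ (FP.toℕ<n x) (FP.toℕ<n y) eq)

  toℤ-≢ : ∀ {x y} → x ≢ y → toℤ x ≉ toℤ y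
  toℤ-≢ x≢y = x≢y ∘ toℤ-injective

  affine : ℤ → ℤ → Fin n → Fin n
  affine A B x = reduce (A * toℤ x + B)

  toℤ-affine : ∀ A B x → toℤ (affine A B x) ≈ A * toℤ x + B
  toℤ-affine A B x = toℤ-reduce (A * toℤ x + B)

  affine-cong : ∀ {A A′ B B′} → A ≈ A′ → B ≈ B′ → ∀ x → affine A B x ≡ affine A′ B′ x
  affine-cong {A} {A′} {B} {B′} A≈A′ B≈B′ x = toℤ-injective (begin
    toℤ (affine A B x)     ≈⟨ toℤ-affine A B x ⟩
    A * toℤ x + B          ≈⟨ +-cong (*-cong A≈A′ ≈-refl) B≈B′ ⟩
    A′ * toℤ x + B′        ≈⟨ ≈-sym (toℤ-affine A′ B′ x) ⟩
    toℤ (affine A′ B′ x)   ∎)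
    where open ≈-Reasoning

  aff≡affine : ∀ a b x → aff n a b x ≡ affine (toℤ a) (toℤ b) x
  aff≡affine a b x = toℤ-injective (begin
    toℤ (aff n a b x)                              ≈⟨ toℤ-mod (toℕ a ℕ.* toℕ x ℕ.+ toℕ b) ⟩
    + (toℕ a ℕ.* toℕ x ℕ.+ toℕ b)                  ≡⟨ ℤP.pos-+ (toℕ a ℕ.* toℕ x) (toℕ b) ⟩
    + (toℕ a ℕ.* toℕ x) + toℤ b                    ≡⟨ cong (_+ toℤ b) (ℤP.pos-* (toℕ a) (toℕ x)) ⟩
    toℤ a * toℤ x + toℤ b                          ≈⟨ ≈-sym (toℤ-affine (toℤ a) (toℤ b) x) ⟩
    toℤ (affine (toℤ a) (toℤ b) x)                 ∎)
    where open ≈-Reasoning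

  SameOrbit⇒affine-image : ∀ {u v} → SameOrbit n u v → ∃₂ λ A B → map₃ (affine A B) u ≡ v
  SameOrbit⇒affine-image {x , y , z} (a , b , _ , refl , refl , refl) =
    toℤ a , toℤ b , sym (cong₂ _,_ (aff≡affine a b x) (cong₂ _,_ (aff≡affine a b y) (aff≡affine a b z)))

  HasRatio : ℤ → Triple (Fin n) → Set
  HasRatio c (x , y , z) = Ratio c (toℤ x) (toℤ y) (toℤ z)

  affine-ratio : ∀ {c} A B t → HasRatio c t → HasRatio c (map₃ (affine A B) t)
  affine-ratio {c} A B (x , y , z) r =
    Ratio-resp (≈-sym (toℤ-affine A B x)) (≈-sym (toℤ-affine A B y)) (≈-sym (toℤ-affine A B z))
               (Ratio-affine A B r)

  HasRatio-middle : ∀ {c x y y′ z} → HasRatio c (x , y , z) → HasRatio c (x , y′ , z) → y ≡ y′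
  HasRatio-middle r r′ = toℤ-injective (Ratio-middle r r′)

  affine-image-by-ends : ∀ {c A B x y z u₁ u₂ u₃} → HasRatio c (x , y , z) → HasRatio c (u₁ , u₂ , u₃) →
    affine A B x ≡ u₁ → affine A B z ≡ u₃ → map₃ (affine A B) (x , y , z) ≡ (u₁ , u₂ , u₃)
  affine-image-by-ends {A = A} {B} {x} {y} {z} r r′ refl refl =
    cong (λ v → affine A B x , v , affine A B z) (HasRatio-middle (affine-ratio A B (x , y , z) r) r′)

module PrimeModulus (p : ℕ) .{{_ : NonZero p}} (isPrime : Prime p) where

  open Modulo p public

  ≉0⇒invertible : ∀ {x} → x ≉ 0ℤ → ∃ λ y → x * y ≈ 1ℤ
  ≉0⇒invertible {x} x≉0 with toℕ (reduce x) | toℤ-reduce x | FP.toℕ<n (reduce x)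
  ... | zero  | r≈x | _   = ⊥-elim (x≉0 (≈-sym r≈x))
  ... | suc r | r≈x | r<p with coprime-Bézout (prime⇒coprime isPrime r<p)
  ...   | Bézout.+- a b eq = - + b , (begin
    x * - + b                        ≈⟨ *-cong (≈-sym r≈x) ≈-refl ⟩
    + suc r * - + b                  ≡⟨ negate-sum (+ suc r) (+ b) ⟩
    1ℤ - (1ℤ + + b * + suc r)        ≡⟨ cong (λ t → 1ℤ - (1ℤ + t)) (sym (ℤP.pos-* b (suc r))) ⟩
    1ℤ - (1ℤ + + (b ℕ.* suc r))      ≈⟨ +-cong (≈-refl {1ℤ}) (-‿cong (pos-≈ a eq)) ⟩
    1ℤ - 0ℤ                          ≡⟨⟩
    1ℤ                               ∎)
    where
    open ≈-Reasoning
    negate-sum : ∀ R B → R * - B ≡ 1ℤ - (1ℤ + B * R)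
    negate-sum = solve-∀
  ...   | Bézout.-+ a b eq = + b , (begin
    x * + b              ≈⟨ *-cong (≈-sym r≈x) ≈-refl ⟩
    + suc r * + b        ≡⟨ ℤP.*-comm (+ suc r) (+ b) ⟩
    + b * + suc r        ≡⟨ ℤP.pos-* b (suc r) ⟨
    + (b ℕ.* suc r)      ≈⟨ pos-≈ a (sym eq) ⟩
    1ℤ                   ∎)
    where open ≈-Reasoning

  *-cancelʳ : ∀ {x y z} → z ≉ 0ℤ → x * z ≈ y * z → x ≈ y
  *-cancelʳ {x} {y} {z} z≉0 eq with ≉0⇒invertible z≉0
  ... | w , zw≈1 = begin
    x               ≡⟨ solve (x ∷ []) ⟩
    x * 1ℤ          ≈⟨ *-congˡ x (≈-sym zw≈1) ⟩
    x * (z * w)     ≡⟨ solve (x ∷ z ∷ w ∷ []) ⟩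
    (x * z) * w     ≈⟨ *-cong eq ≈-refl ⟩
    (y * z) * w     ≡⟨ solve (y ∷ z ∷ w ∷ []) ⟩
    y * (z * w)     ≈⟨ *-congˡ y zw≈1 ⟩
    y * 1ℤ          ≡⟨ solve (y ∷ []) ⟩
    y               ∎
    where open ≈-Reasoning

  private
    difference≉0 : ∀ {x y} → x ≉ y → y - x ≉ 0ℤ
    difference≉0 x≉y y-x≈0 = x≉y (≈-sym (-≈0⇒≈ y-x≈0))

  Ratio-unique : ∀ {c c′ X Y Z} → X ≉ Z → Ratio c X Y Z → Ratio c′ X Y Z → c ≈ c′
  Ratio-unique {c} {c′} {X} {Y} {Z} X≉Z (ratio r) (ratio r′) =
    *-cancelʳ {c} {c′} {Z - X} (difference≉0 X≉Z) (≈-trans (≈-sym r) r′)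

  Ratio-exists : ∀ {X Z} Y → X ≉ Z → ∃ λ c → Ratio c X Y Z
  Ratio-exists {X} {Z} Y X≉Z = from-inverse (≉0⇒invertible (difference≉0 X≉Z))
    where
    from-inverse : (∃ λ w → (Z - X) * w ≈ 1ℤ) → ∃ λ c → Ratio c X Y Z
    from-inverse (w , dw≈1) = (Y - X) * w , ratio (begin
      Y - X                      ≡⟨ solve (X ∷ Y ∷ []) ⟩
      (Y - X) * 1ℤ               ≈⟨ *-congˡ (Y - X) (≈-sym dw≈1) ⟩
      (Y - X) * ((Z - X) * w)    ≡⟨ solve (X ∷ Y ∷ Z ∷ w ∷ []) ⟩
      ((Y - X) * w) * (Z - X)    ∎)
      where open ≈-Reasoning

  affine-injective : ∀ {A} B → A ≉ 0ℤ → Injective _≡_ _≡_ (affine A B)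
  affine-injective {A} B A≉0 {x} {y} eq = toℤ-injective (*-cancelʳ A≉0 (begin
    toℤ x * A          ≡⟨ ℤP.*-comm (toℤ x) A ⟩
    A * toℤ x          ≈⟨ +-cancelʳ (begin
      A * toℤ x + B        ≈⟨ ≈-sym (toℤ-affine A B x) ⟩
      toℤ (affine A B x)   ≡⟨ cong toℤ eq ⟩
      toℤ (affine A B y)   ≈⟨ toℤ-affine A B y ⟩
      A * toℤ y + B        ∎) ⟩
    A * toℤ y          ≡⟨ ℤP.*-comm A (toℤ y) ⟩
    toℤ y * A          ∎))
    where open ≈-Reasoning

  affine-determinedℤ : ∀ {A A′ B B′ X Y} → X ≉ Y →
    A * X + B ≈ A′ * X + B′ → A * Y + B ≈ A′ * Y + B′ → A ≈ A′ × B ≈ B′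
  affine-determinedℤ {A} {A′} {B} {B′} {X} {Y} X≉Y eX eY = A≈A′ , (begin
    B                   ≡⟨ solve (A ∷ B ∷ X ∷ []) ⟩
    (A * X + B) - A * X ≈⟨ +-cong eX (-‿cong (*-cong A≈A′ ≈-refl)) ⟩
    (A′ * X + B′) - A′ * X ≡⟨ solve (A′ ∷ B′ ∷ X ∷ []) ⟩
    B′                  ∎)
    where
    open ≈-Reasoning
    A≈A′ : A ≈ A′
    A≈A′ = *-cancelʳ {A} {A′} {Y - X} (difference≉0 X≉Y) (begin
      A * (Y - X)                    ≡⟨ solve (A ∷ B ∷ X ∷ Y ∷ []) ⟩
      (A * Y + B) - (A * X + B)      ≈⟨ +-cong eY (-‿cong eX) ⟩
      (A′ * Y + B′) - (A′ * X + B′)  ≡⟨ solve (A′ ∷ B′ ∷ X ∷ Y ∷ []) ⟩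
      A′ * (Y - X)                   ∎)

  affine-throughℤ : ∀ {X Y U V} → X ≉ Y → U ≉ V →
    ∃₂ λ A B → A ≉ 0ℤ × A * X + B ≈ U × A * Y + B ≈ V
  affine-throughℤ {X} {Y} {U} {V} X≉Y U≉V = from-inverse (≉0⇒invertible (difference≉0 X≉Y))
    where
    open ≈-Reasoning
    through : ∀ A → A * (Y - X) ≈ V - U → ∃₂ λ A′ B → A′ ≉ 0ℤ × A′ * X + B ≈ U × A′ * Y + B ≈ V
    through A slope = A , U - A * X , A≉0 , ≈-reflexive (solve (A ∷ U ∷ X ∷ [])) , (begin
      A * Y + (U - A * X)      ≡⟨ solve (A ∷ U ∷ X ∷ Y ∷ []) ⟩
      A * (Y - X) + U          ≈⟨ +-cong slope ≈-refl ⟩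
      (V - U) + U              ≡⟨ solve (U ∷ V ∷ []) ⟩
      V                        ∎)
      where
      A≉0 : A ≉ 0ℤ
      A≉0 A≈0 = U≉V (≈-sym (-≈0⇒≈ (begin
        V - U                    ≈⟨ ≈-sym slope ⟩
        A * (Y - X)              ≈⟨ *-cong A≈0 ≈-refl ⟩
        0ℤ * (Y - X)             ≡⟨ ℤP.*-zeroˡ (Y - X) ⟩
        0ℤ                       ∎)))
    from-inverse : (∃ λ w → (Y - X) * w ≈ 1ℤ) → ∃₂ λ A B → A ≉ 0ℤ × A * X + B ≈ U × A * Y + B ≈ V
    from-inverse (w , dw≈1) = through ((V - U) * w) (begin
      (V - U) * w * (Y - X)    ≡⟨ solve (U ∷ V ∷ w ∷ X ∷ Y ∷ []) ⟩
      (V - U) * ((Y - X) * w)  ≈⟨ *-congˡ (V - U) dw≈1 ⟩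
      (V - U) * 1ℤ             ≡⟨ solve (U ∷ V ∷ []) ⟩
      V - U                    ∎)

  affine-determined : ∀ {A A′ B B′ x y} → x ≢ y →
    affine A B x ≡ affine A′ B′ x → affine A B y ≡ affine A′ B′ y → A ≈ A′ × B ≈ B′
  affine-determined {A} {A′} {B} {B′} {x} {y} x≢y ex ey =
    affine-determinedℤ (toℤ-≢ x≢y) (agree ex) (agree ey)
    where
    agree : ∀ {z} → affine A B z ≡ affine A′ B′ z → A * toℤ z + B ≈ A′ * toℤ z + B′
    agree {z} e = ≈-trans (≈-sym (toℤ-affine A B z)) (≈-trans (≈-reflexive (cong toℤ e)) (toℤ-affine A′ B′ z))

  affine-through : ∀ {x y u v} → x ≢ y → u ≢ v →
    ∃₂ λ A B → A ≉ 0ℤ × affine A B x ≡ u × affine A B y ≡ v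
  affine-through {x} {y} {u} {v} x≢y u≢v =
    let A , B , A≉0 , ex , ey = affine-throughℤ (toℤ-≢ x≢y) (toℤ-≢ u≢v)
    in A , B , A≉0 , toℤ-injective (≈-trans (toℤ-affine A B x) ex) , toℤ-injective (≈-trans (toℤ-affine A B y) ey)

-- The zigzag 0, 1, -1, 2, -2, … in ℤ

σ : ℕ → ℤ
σ zero          = 1ℤ
σ (suc zero)    = -1ℤ
σ (suc (suc i)) = σ i

σ-suc : ∀ i → σ (suc i) ≡ - σ i
σ-suc zero          = refl
σ-suc (suc zero)    = refl
σ-suc (suc (suc i)) = σ-suc i

σ-even : ∀ j → σ (double j) ≡ 1ℤ
σ-even zero    = refl
σ-even (suc j) = σ-even j

σ-odd : ∀ j → σ (suc (double j)) ≡ -1ℤ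
σ-odd zero    = refl
σ-odd (suc j) = σ-odd j

zigzagℤ : ℕ → ℤ
zigzagℤ zero    = 0ℤ
zigzagℤ (suc i) = zigzagℤ i + σ i * + suc i

pos-suc-double : ∀ j → + suc (double j) ≡ 1ℤ + (+ j + + j)
pos-suc-double j = trans (ℤP.pos-+ 1 (double j)) (cong (λ t → 1ℤ + t) (trans (cong +_ (double≡+ j)) (ℤP.pos-+ j j)))

zigzagℤ-even : ∀ j → zigzagℤ (double j) ≡ - + j
zigzagℤ-odd  : ∀ j → zigzagℤ (suc (double j)) ≡ + suc j

zigzagℤ-even zero    = refl
zigzagℤ-even (suc j) = begin
  zigzagℤ (suc (double j)) + σ (suc (double j)) * + suc (suc (double j))
    ≡⟨ cong₂ (λ z s → z + s * + suc (suc (double j))) (zigzagℤ-odd j) (σ-odd j) ⟩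
  + suc j + -1ℤ * + suc (suc (double j))
    ≡⟨ cong₂ (λ a b → a + -1ℤ * b) (ℤP.pos-+ 1 j) (trans (ℤP.pos-+ 1 (suc (double j))) (cong (λ t → 1ℤ + t) (pos-suc-double j))) ⟩
  (1ℤ + + j) + -1ℤ * (1ℤ + (1ℤ + (+ j + + j)))
    ≡⟨ identity (+ j) ⟩
  - (1ℤ + + j)
    ≡⟨ cong -_ (ℤP.pos-+ 1 j) ⟨
  - + suc j ∎
  where
  open ≡-Reasoning
  identity : ∀ J → (1ℤ + J) + -1ℤ * (1ℤ + (1ℤ + (J + J))) ≡ - (1ℤ + J)
  identity = solve-∀

zigzagℤ-odd j = begin
  zigzagℤ (double j) + σ (double j) * + suc (double j)
    ≡⟨ cong₂ (λ z s → z + s * + suc (double j)) (zigzagℤ-even j) (σ-even j) ⟩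
  - + j + 1ℤ * + suc (double j)
    ≡⟨ cong (λ t → - + j + 1ℤ * t) (pos-suc-double j) ⟩
  - + j + 1ℤ * (1ℤ + (+ j + + j))
    ≡⟨ identity (+ j) ⟩
  1ℤ + + j
    ≡⟨ ℤP.pos-+ 1 j ⟨
  + suc j ∎
  where
  open ≡-Reasoning
  identity : ∀ J → - J + 1ℤ * (1ℤ + (J + J)) ≡ 1ℤ + J
  identity = solve-∀

zigzagℤ-window : ∀ i →
  zigzagℤ (suc i) - zigzagℤ i ≡ - + suc i * (zigzagℤ (suc (suc i)) - zigzagℤ i)
zigzagℤ-window i = begin
  zigzagℤ (suc i) - zigzagℤ i
    ≡⟨ identity (zigzagℤ i) (σ i) (+ suc i) ⟩
  - + suc i * ((zigzagℤ (suc i) + - σ i * (1ℤ + + suc i)) - zigzagℤ i)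
    ≡⟨ cong (λ t → - + suc i * ((zigzagℤ (suc i) + t) - zigzagℤ i))
            (sym (cong₂ _*_ (σ-suc i) (ℤP.pos-+ 1 (suc i)))) ⟩
  - + suc i * (zigzagℤ (suc (suc i)) - zigzagℤ i) ∎
  where
  open ≡-Reasoning
  identity : ∀ Z S K → (Z + S * K) - Z ≡ - K * (((Z + S * K) + - S * (1ℤ + K)) - Z)
  identity = solve-∀

-- The zigzag modulo p = 2h + 3

module Zigzag (h : ℕ) (isPrime : Prime (suc (suc (suc (double h))))) where

  p : ℕ
  p = suc (suc (suc (double h)))

  open PrimeModulus p isPrime

  windowCount : ℕ
  windowCount = suc (double h)

  zigzagAt : ℕ → Fin p
  zigzagAt zero    = 0 mod p
  zigzagAt (suc i) = interleave (λ j → suc j mod p) (λ j → (p ℕ.∸ suc j) mod p) i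

  zigzagList : List (Fin p)
  zigzagList = applyUpTo zigzagAt p

  zigzag≡zigzagList : zigzag p ≡ zigzagList
  zigzag≡zigzagList = begin
    zigzag p                                           ≡⟨ cong (λ k → 0 mod p ∷ concatMap pair (map suc (upTo k))) half ⟩
    0 mod p ∷ concatMap pair (map suc (upTo (suc h)))  ≡⟨ cong (λ js → 0 mod p ∷ concatMap pair js) (map-upTo suc (suc h)) ⟩
    0 mod p ∷ concatMap pair (applyUpTo suc (suc h))   ≡⟨ cong (0 mod p ∷_) (concatMap-pairs _ _ suc (suc h)) ⟩
    zigzagList                                         ∎
    where
    open ≡-Reasoning
    pair : ℕ → List (Fin p)
    pair j = j mod p ∷ (p ℕ.∸ j) mod p ∷ []
    half : (p ℕ.∸ 1) / 2 ≡ suc h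
    half = trans (cong (_/ 2) (double≡*2 (suc h))) (m*n/n≡m (suc h) 2)

  zigzagAt-≈ : ∀ i → i ≤ p → toℤ (zigzagAt i) ≈ zigzagℤ i
  zigzagAt-≈ i i≤p with parity i
  ... | even zero    = toℤ-mod 0
  ... | even (suc j) = begin
    toℤ (zigzagAt (double (suc j)))   ≡⟨ cong toℤ (interleave-odd _ _ j) ⟩
    toℤ ((p ℕ.∸ suc j) mod p)         ≈⟨ toℤ-mod (p ℕ.∸ suc j) ⟩
    + (p ℕ.∸ suc j)                   ≈⟨ +≡⇒≈- (trans (sym (ℤP.pos-+ (p ℕ.∸ suc j) (suc j))) (cong +_ (ℕP.m∸n+n≡m j<p))) ⟩
    - + suc j                         ≡⟨ zigzagℤ-even (suc j) ⟨
    zigzagℤ (double (suc j))          ∎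
    where
    open ≈-Reasoning
    j<p : suc j ≤ p
    j<p = ℕP.≤-trans (n≤double (suc j)) i≤p
  ... | odd j = begin
    toℤ (zigzagAt (suc (double j)))   ≡⟨ cong toℤ (interleave-even _ _ j) ⟩
    toℤ (suc j mod p)                 ≈⟨ toℤ-mod (suc j) ⟩
    + suc j                           ≡⟨ zigzagℤ-odd j ⟨
    zigzagℤ (suc (double j))          ∎
    where open ≈-Reasoning

  private
    even-bound : ∀ {a} → double a < p → a ≤ suc h
    even-bound lt = double-≤-reflect (ℕP.≤-trans (ℕP.≤-pred lt) (ℕP.n≤1+n _))

    odd-bound : ∀ {b} → suc (double b) < p → b ≤ h
    odd-bound lt = double-≤-reflect (ℕP.≤-pred (ℕP.≤-pred lt))

    below-half⇒<p : ∀ {a} → a ≤ suc h → a < p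
    below-half⇒<p a≤ = s≤s (ℕP.≤-trans a≤ (n≤double (suc h)))

    mixed-parity : ∀ {a b} → a ≤ suc h → b ≤ h → - + a ≉ + suc b
    mixed-parity {a} {b} a≤ b≤ e = ℕP.1+n≢0 (trans (sym (ℕP.+-suc a b)) (≈⇒≡ sum<p (s≤s z≤n) (begin
      + (a ℕ.+ suc b)    ≡⟨ ℤP.pos-+ a (suc b) ⟩
      + a + + suc b      ≈⟨ +-cong (≈-refl {+ a}) (≈-sym e) ⟩
      + a + - + a        ≡⟨ ℤP.+-inverseʳ (+ a) ⟩
      0ℤ                 ∎)))
      where
      open ≈-Reasoning
      sum<p : a ℕ.+ suc b < p
      sum<p = s≤s (ℕP.≤-trans (ℕP.+-mono-≤ a≤ (s≤s b≤)) (ℕP.≤-reflexive (sym (double≡+ (suc h)))))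

  zigzagℤ-injective : ∀ {i j} → i < p → j < p → zigzagℤ i ≈ zigzagℤ j → i ≡ j
  zigzagℤ-injective {i} {j} i<p j<p e with parity i | parity j
  ... | even a | even b = cong double (≈⇒≡ (below-half⇒<p (even-bound i<p)) (below-half⇒<p (even-bound j<p))
        (-‿cancel (subst₂ _≈_ (zigzagℤ-even a) (zigzagℤ-even b) e)))
  ... | odd a | odd b = cong (suc ∘ double) (ℕP.suc-injective (≈⇒≡ (below-half⇒<p (s≤s (odd-bound i<p)))
        (below-half⇒<p (s≤s (odd-bound j<p))) (subst₂ _≈_ (zigzagℤ-odd a) (zigzagℤ-odd b) e)))
  ... | even a | odd b = ⊥-elim (mixed-parity (even-bound i<p) (odd-bound j<p)
        (subst₂ _≈_ (zigzagℤ-even a) (zigzagℤ-odd b) e))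
  ... | odd a | even b = ⊥-elim (mixed-parity (even-bound j<p) (odd-bound i<p)
        (subst₂ _≈_ (zigzagℤ-even b) (zigzagℤ-odd a) (≈-sym e)))

  zigzagAt-injective : ∀ {i j} → i < p → j < p → zigzagAt i ≡ zigzagAt j → i ≡ j
  zigzagAt-injective {i} {j} i<p j<p eq = zigzagℤ-injective i<p j<p (begin
    zigzagℤ i           ≈⟨ ≈-sym (zigzagAt-≈ i (ℕP.<⇒≤ i<p)) ⟩
    toℤ (zigzagAt i)    ≡⟨ cong toℤ eq ⟩
    toℤ (zigzagAt j)    ≈⟨ zigzagAt-≈ j (ℕP.<⇒≤ j<p) ⟩
    zigzagℤ j           ∎)
    where open ≈-Reasoning

  zigzagList-unique : Unique zigzagList
  zigzagList-unique = Unique.applyUpTo⁺₁ zigzagAt p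
    (λ i<j j<p → ℕP.<⇒≢ i<j ∘ zigzagAt-injective (ℕP.<-trans i<j j<p) j<p)

  zigzagList-complete : ∀ y → y ∈ zigzagList
  zigzagList-complete y =
    let x , eq = Fin-injective⇒surjective (zigzagAt ∘ toℕ)
                   (λ {x} {x′} → FP.toℕ-injective ∘ zigzagAt-injective (FP.toℕ<n x) (FP.toℕ<n x′)) y
    in subst (_∈ zigzagList) eq (∈-applyUpTo⁺ zigzagAt (FP.toℕ<n x))

  zigzagList↭allFin : zigzagList ↭ allFin p
  zigzagList↭allFin = unique∧complete⇒↭allFin zigzagList-unique zigzagList-complete

  window : ℕ → Triple (Fin p)
  window i = zigzagAt i , zigzagAt (suc i) , zigzagAt (suc (suc i))

  windows3-zigzagList : windows3 zigzagList ≡ applyUpTo window windowCount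
  windows3-zigzagList = windows3-applyUpTo zigzagAt windowCount

  private
    window-end<p : ∀ {i} → i < windowCount → suc (suc i) < p
    window-end<p i<w = s≤s (s≤s i<w)

  window-ratio : ∀ {i} → i < windowCount → HasRatio (- + suc i) (window i)
  window-ratio {i} i<w =
    Ratio-resp (≈-sym (zigzagAt-≈ i (ℕP.≤-trans (ℕP.n≤1+n i) (ℕP.≤-trans (ℕP.n≤1+n (suc i)) end≤p))))
               (≈-sym (zigzagAt-≈ (suc i) (ℕP.≤-trans (ℕP.n≤1+n (suc i)) end≤p)))
               (≈-sym (zigzagAt-≈ (suc (suc i)) end≤p))
               (ratio (≈-reflexive (zigzagℤ-window i)))
    where
    end≤p : suc (suc i) ≤ p
    end≤p = ℕP.<⇒≤ (window-end<p i<w)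

  window-ends-distinct : ∀ {i} → i < windowCount → zigzagAt i ≢ zigzagAt (suc (suc i))
  window-ends-distinct {i} i<w eq = ℕP.<⇒≢ (s≤s (ℕP.n≤1+n i))
    (zigzagAt-injective (ℕP.<-trans (s≤s (ℕP.n≤1+n i)) (window-end<p i<w)) (window-end<p i<w) eq)

  ratio-index-unique : ∀ {i j x y z} → i < windowCount → j < windowCount → x ≢ z →
    HasRatio (- + suc i) (x , y , z) → HasRatio (- + suc j) (x , y , z) → i ≡ j
  ratio-index-unique i<w j<w x≢z rᵢ rⱼ =
    ℕP.suc-injective (≈⇒≡ (suc<p i<w) (suc<p j<w) (-‿cancel (Ratio-unique (toℤ-≢ x≢z) rᵢ rⱼ)))
    where
    suc<p : ∀ {k} → k < windowCount → suc k < p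
    suc<p k<w = ℕP.<-trans (s≤s k<w) (ℕP.n<1+n _)

  windows-in-distinct-orbits : ∀ {i j} → i < windowCount → j < windowCount →
    SameOrbit p (window i) (window j) → i ≡ j
  windows-in-distinct-orbits {i} i<w j<w same =
    let A , B , image = SameOrbit⇒affine-image same
    in ratio-index-unique i<w j<w (window-ends-distinct j<w)
         (subst (HasRatio _) image (affine-ratio A B (window i) (window-ratio i<w))) (window-ratio j<w)

  isSequencing : IsSequencing p (zigzag p)
  isSequencing rewrite zigzag≡zigzagList | windows3-zigzagList =
    zigzagList↭allFin ,
    AllPairs.applyUpTo⁺₁ window windowCount
      (λ i<j j<w → ℕP.<⇒≢ i<j ∘ windows-in-distinct-orbits (ℕP.<-trans i<j j<w) j<w)

  -- Index k of the design ↔ the affine map x ↦ a x + b with a = 1 + α, where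
  -- (α , b) = decode k ranges over Fin (p - 1) × Fin (p * 1), and p P 2 unfolds to (p - 1) * (p * 1).
  decode : Fin (p P 2) → Fin (p ℕ.∸ 1) × Fin (p ℕ.* 1)
  decode = F.remQuot {p ℕ.∸ 1} (p ℕ.* 1)

  encode : Fin (p ℕ.∸ 1) × Fin (p ℕ.* 1) → Fin (p P 2)
  encode = uncurry (F.combine {p ℕ.∸ 1} {p ℕ.* 1})

  slope intercept : Fin (p P 2) → ℤ
  slope     k = + suc (toℕ (proj₁ (decode k)))
  intercept k = + toℕ (proj₂ (decode k))

  slope≉0 : ∀ k → slope k ≉ 0ℤ
  slope≉0 k = ℕP.1+n≢0 ∘ ≈⇒≡ (s≤s (FP.toℕ<n (proj₁ (decode k)))) (s≤s z≤n)

  coefficients-injective : ∀ {k k′} → slope k ≈ slope k′ → intercept k ≈ intercept k′ → k ≡ k′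
  coefficients-injective {k} {k′} slope≈ intercept≈ = begin
    k                  ≡⟨ FP.combine-remQuot {p ℕ.∸ 1} (p ℕ.* 1) k ⟨
    encode (decode k)  ≡⟨ cong₂ (F.combine {p ℕ.∸ 1} {p ℕ.* 1}) α≡α′ β≡β′ ⟩
    encode (decode k′) ≡⟨ FP.combine-remQuot {p ℕ.∸ 1} (p ℕ.* 1) k′ ⟩
    k′                 ∎
    where
    open ≡-Reasoning
    α≡α′ : proj₁ (decode k) ≡ proj₁ (decode k′)
    α≡α′ = FP.toℕ-injective (ℕP.suc-injective (≈⇒≡ (s≤s (FP.toℕ<n _)) (s≤s (FP.toℕ<n _)) slope≈))
    β<p : ∀ (β : Fin (p ℕ.* 1)) → toℕ β < p
    β<p β = subst (toℕ β <_) (ℕP.*-identityʳ p) (FP.toℕ<n β)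
    β≡β′ : proj₂ (decode k) ≡ proj₂ (decode k′)
    β≡β′ = FP.toℕ-injective (≈⇒≡ (β<p _) (β<p _) intercept≈)

  coefficients-surjective : ∀ {A B} → A ≉ 0ℤ → ∃ λ k → slope k ≈ A × intercept k ≈ B
  coefficients-surjective {A} {B} A≉0 = from-slope (reduce A) (toℤ-reduce A)
    where
    β : Fin (p ℕ.* 1)
    β = F.cast (sym (ℕP.*-identityʳ p)) (reduce B)
    from-slope : ∀ a → toℤ a ≈ A → ∃ λ k → slope k ≈ A × intercept k ≈ B
    from-slope F.zero    a≈A = ⊥-elim (A≉0 (≈-sym a≈A))
    from-slope (F.suc α) a≈A =
      encode (α , β) ,
      ≈-trans (≈-reflexive (cong (λ t → + suc (toℕ (proj₁ t))) decode∘encode)) a≈A ,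
      ≈-trans (≈-reflexive (trans (cong (λ t → + toℕ (proj₂ t)) decode∘encode) (cong +_ (FP.toℕ-cast _ (reduce B)))))
              (toℤ-reduce B)
      where
      decode∘encode : decode (encode (α , β)) ≡ (α , β)
      decode∘encode = FP.remQuot-combine α β

  perm : Fin (p P 2) → Fin p → Fin p
  perm k = affine (slope k) (intercept k)

  perm-injective : ∀ k → Injective _≡_ _≡_ (perm k)
  perm-injective k = affine-injective (intercept k) (slope≉0 k)

  Π : Fin (p P 2) → List (Fin p)
  Π k = map (perm k) zigzagList

  Π-unique : ∀ k → Unique (Π k)
  Π-unique k = Unique.map⁺ (perm-injective k) zigzagList-unique

  Π↭allFin : ∀ k → Π k ↭ allFin p
  Π↭allFin k = unique∧complete⇒↭allFin (Π-unique k) λ y →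
    let x , eq = Fin-injective⇒surjective (perm k) (perm-injective k) y
    in subst (_∈ Π k) eq (∈-map⁺ (perm k) (zigzagList-complete x))

  Π-injective : Injective _≡_ _≡_ Π
  Π-injective {k} {k′} eq =
    let at₀ , rest = ∷-injective eq
        at₁ , _    = ∷-injective rest
        zigzag₀≢zigzag₁ = λ e → ℕP.0≢1+n (zigzagAt-injective (s≤s z≤n) (s≤s (s≤s z≤n)) e)
    in uncurry coefficients-injective (affine-determined zigzag₀≢zigzag₁ at₀ at₁)

  windows3-Π : ∀ k → windows3 (Π k) ≡ map (map₃ (perm k)) (applyUpTo window windowCount)
  windows3-Π k = trans (windows3-map (perm k) zigzagList) (cong (map (map₃ (perm k))) windows3-zigzagList)

  window-of-Π : ∀ k {t} → t ∈ windows3 (Π k) → ∃ λ i → i < windowCount × map₃ (perm k) (window i) ≡ t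
  window-of-Π k {t} t∈ =
    let w , w∈ , t≡ = ∈-map⁻ (map₃ (perm k)) (subst (t ∈_) (windows3-Π k) t∈)
        i , i<w , w≡ = ∈-applyUpTo⁻ window w∈
    in i , i<w , sym (trans t≡ (cong (map₃ (perm k)) w≡))

  window-in-Π : ∀ k {i} → i < windowCount → map₃ (perm k) (window i) ∈ windows3 (Π k)
  window-in-Π k {i} i<w =
    subst (map₃ (perm k) (window i) ∈_) (sym (windows3-Π k)) (∈-map⁺ (map₃ (perm k)) (∈-applyUpTo⁺ window i<w))

  ratio-index : ∀ {c} → c ≉ 0ℤ → c ≉ 1ℤ → ∃ λ i → i < windowCount × - + suc i ≈ c
  ratio-index {c} c≉0 c≉1 = index (toℕ (reduce (- c))) (toℤ-reduce (- c)) (FP.toℕ<n (reduce (- c)))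
    where
    index : ∀ r → + r ≈ - c → r < p → ∃ λ i → i < windowCount × - + suc i ≈ c
    index zero    r≈ _ = ⊥-elim (c≉0 (-‿cancel (≈-sym r≈)))
    index (suc i) r≈ (s≤s i<1+w) with i ℕ.≟ windowCount
    ... | yes refl = ⊥-elim (c≉1 (-‿cancel (≈-trans (≈-sym r≈) (+≡⇒≈- p-1+1≡p))))
      where
      p-1+1≡p : + suc windowCount + 1ℤ ≡ + p
      p-1+1≡p = trans (sym (ℤP.pos-+ (suc windowCount) 1)) (cong +_ (ℕP.+-comm (suc windowCount) 1))
    ... | no i≢w   = i , ℕP.≤∧≢⇒< (ℕP.≤-pred i<1+w) i≢w , ≈-trans (-‿cong r≈) (≈-reflexive (ℤP.neg-involutive c))

  distinct-triple-ratio : ∀ {u₁ u₂ u₃} → u₁ ≢ u₂ → u₁ ≢ u₃ → u₂ ≢ u₃ →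
    ∃ λ i → i < windowCount × HasRatio (- + suc i) (u₁ , u₂ , u₃)
  distinct-triple-ratio {u₁} {u₂} {u₃} u₁≢u₂ u₁≢u₃ u₂≢u₃ =
    let c , r = Ratio-exists (toℤ u₂) (toℤ-≢ u₁≢u₃)
        i , i<w , -i-1≈c = ratio-index (c≉0 r) (c≉1 r)
    in i , i<w , Ratio-cong (≈-sym -i-1≈c) r
    where
    c≉0 : ∀ {c} → HasRatio c (u₁ , u₂ , u₃) → c ≉ 0ℤ
    c≉0 r c≈0 = u₁≢u₂ (HasRatio-middle (Ratio-zero _ _) (Ratio-cong c≈0 r))
    c≉1 : ∀ {c} → HasRatio c (u₁ , u₂ , u₃) → c ≉ 1ℤ
    c≉1 r c≈1 = u₂≢u₃ (HasRatio-middle (Ratio-cong c≈1 r) (Ratio-one _ _))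

  affine-window-image : ∀ {i A B u₁ u₂ u₃} → i < windowCount → A ≉ 0ℤ →
    HasRatio (- + suc i) (u₁ , u₂ , u₃) →
    affine A B (zigzagAt i) ≡ u₁ → affine A B (zigzagAt (suc (suc i))) ≡ u₃ →
    ∃ λ k → map₃ (perm k) (window i) ≡ (u₁ , u₂ , u₃)
  affine-window-image {i} {A} {B} {u₁} {u₂} {u₃} i<w A≉0 r e₁ e₃ = from-index (coefficients-surjective {A} {B} A≉0)
    where
    from-index : (∃ λ k → slope k ≈ A × intercept k ≈ B) → ∃ λ k → map₃ (perm k) (window i) ≡ (u₁ , u₂ , u₃)
    from-index (k , slope≈ , intercept≈) =
      k , affine-image-by-ends {A = slope k} {intercept k} (window-ratio i<w) r
            (trans (affine-cong slope≈ intercept≈ (zigzagAt i)) e₁)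
            (trans (affine-cong slope≈ intercept≈ (zigzagAt (suc (suc i)))) e₃)

  window-image-exists : ∀ {u₁ u₂ u₃} → u₁ ≢ u₂ → u₁ ≢ u₃ → u₂ ≢ u₃ →
    ∃₂ λ k i → i < windowCount × map₃ (perm k) (window i) ≡ (u₁ , u₂ , u₃)
  window-image-exists {u₁} {u₂} {u₃} u₁≢u₂ u₁≢u₃ u₂≢u₃ = from-ratio (distinct-triple-ratio u₁≢u₂ u₁≢u₃ u₂≢u₃)
    where
    from-ratio : (∃ λ i → i < windowCount × HasRatio (- + suc i) (u₁ , u₂ , u₃)) →
                 ∃₂ λ k i → i < windowCount × map₃ (perm k) (window i) ≡ (u₁ , u₂ , u₃)
    from-ratio (i , i<w , r) =
      let A , B , A≉0 , e₁ , e₃ = affine-through (window-ends-distinct i<w) u₁≢u₃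
          k , image = affine-window-image {i} {A} {B} i<w A≉0 r e₁ e₃
      in k , i , i<w , image

  window-image-unique : ∀ {k k′ i j u₁ u₂ u₃} → i < windowCount → j < windowCount → u₁ ≢ u₃ →
    map₃ (perm k) (window i) ≡ (u₁ , u₂ , u₃) → map₃ (perm k′) (window j) ≡ (u₁ , u₂ , u₃) → k ≡ k′
  window-image-unique {k} {k′} {i} {j} i<w j<w u₁≢u₃ image image′ = same-coefficients i≡j (trans image′ (sym image))
    where
    i≡j : i ≡ j
    i≡j = ratio-index-unique i<w j<w u₁≢u₃
            (subst (HasRatio _) image (affine-ratio (slope k) (intercept k) (window i) (window-ratio i<w)))
            (subst (HasRatio _) image′ (affine-ratio (slope k′) (intercept k′) (window j) (window-ratio j<w)))
    same-coefficients : ∀ {j} → i ≡ j → map₃ (perm k′) (window j) ≡ map₃ (perm k) (window i) → k ≡ k′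
    same-coefficients refl image″ = uncurry coefficients-injective
      (affine-determined (window-ends-distinct i<w) (sym (cong proj₁ image″)) (sym (cong (proj₂ ∘ proj₂) image″)))

  UniqueOccurrence : List (Fin p) → Set
  UniqueOccurrence u = Σ (Fin (p P 2) × List (Fin p) × List (Fin p)) λ { (k , pre , suf) →
    (Π k ≡ pre ++ u ++ suf) × (∀ k′ pre′ suf′ → Π k′ ≡ pre′ ++ u ++ suf′ → (k′ ≡ k) × (pre′ ≡ pre)) }

  occurs-only-in : ∀ {k k′ i u₁ u₂ u₃} pre′ suf′ → i < windowCount → u₁ ≢ u₃ →
    map₃ (perm k) (window i) ≡ (u₁ , u₂ , u₃) → Π k′ ≡ pre′ ++ u₁ ∷ u₂ ∷ u₃ ∷ suf′ → k′ ≡ k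
  occurs-only-in {k} {k′} {i} {u₁} {u₂} {u₃} pre′ suf′ i<w u₁≢u₃ image split′ = from-window (window-of-Π k′ u∈Π′)
    where
    u∈Π′ : (u₁ , u₂ , u₃) ∈ windows3 (Π k′)
    u∈Π′ = subst (λ xs → (u₁ , u₂ , u₃) ∈ windows3 xs) (sym split′) (∈-windows3⁺ pre′ suf′)
    from-window : (∃ λ j → j < windowCount × map₃ (perm k′) (window j) ≡ (u₁ , u₂ , u₃)) → k′ ≡ k
    from-window (j , j<w , image′) =
      window-image-unique {k′} {k} {j} {i} {u₁} {u₂} {u₃} j<w i<w u₁≢u₃ image′ image

  unique-occurrence : ∀ u → length u ≡ 3 → Unique u → UniqueOccurrence u
  unique-occurrence (u₁ ∷ u₂ ∷ u₃ ∷ []) refl distinct =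
    let u₁≢u₂ , u₁≢u₃ , u₂≢u₃ = Unique-triple⇒distinct distinct
    in from-window u₁≢u₃ (window-image-exists u₁≢u₂ u₁≢u₃ u₂≢u₃)
    where
    from-window : u₁ ≢ u₃ → (∃₂ λ k i → i < windowCount × map₃ (perm k) (window i) ≡ (u₁ , u₂ , u₃)) →
                  UniqueOccurrence (u₁ ∷ u₂ ∷ u₃ ∷ [])
    from-window u₁≢u₃ (k , i , i<w , image) =
      from-split (∈-windows3⁻ (Π k) (subst (_∈ windows3 (Π k)) image (window-in-Π k i<w)))
      where
      from-split : (∃₂ λ pre suf → Π k ≡ pre ++ u₁ ∷ u₂ ∷ u₃ ∷ suf) → UniqueOccurrence (u₁ ∷ u₂ ∷ u₃ ∷ [])
      from-split (pre , suf , split) = (k , pre , suf) , split , λ k′ pre′ suf′ split′ →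
        let k′≡k = occurs-only-in {k} {k′} {i} {u₁} {u₂} {u₃} pre′ suf′ i<w u₁≢u₃ image split′
        in k′≡k , sym (Unique-prefix pre pre′ (subst Unique split (Π-unique k))
                         (trans (sym split) (trans (cong Π (sym k′≡k)) split′)))

  permDesign : PermDesignExists p 3
  permDesign = Π , Π-injective , Π↭allFin , unique-occurrence

odd-prime-form : ∀ p → Prime p → 2 < p → ∃ λ h → p ≡ suc (suc (suc (double h)))
odd-prime-form p isPrime 2<p with parity p
... | even j with prime⇒irreducible isPrime (divides j (double≡*2 j))
...   | inj₁ ()
...   | inj₂ 2≡p = ⊥-elim (ℕP.<-irrefl 2≡p 2<p)
odd-prime-form _ _ (s≤s ()) | odd zero
odd-prime-form _ _ _        | odd (suc h) = h , refl

theorem4p2 : (p : ℕ) .{{_ : NonZero p}} → Prime p → 2 < p →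
    IsSequencing p (zigzag p) × PermDesignExists p 3
theorem4p2 p isPrime 2<p with odd-prime-form p isPrime 2<p
... | h , refl = Zigzag.isSequencing h isPrime , Zigzag.permDesign h isPrime
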